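{- Let $G$ be a finite group of morphisms and antimorphisms of $\mathcal A^*$ containing at least one antimorphism, and let $\mathbf u$ be an infinite word over $\mathcal A$. (1) If $\mathbf u$ has Property $G$-lps$(1)$, then $\mathbf u$ has Property $G$-crw$(1)$. (2) If $\mathbf u$ has Property $G$-lps$(N)$ for some integer $N>1$, then $\mathbf u$ has Property $G$-crw$(N-1)$.
   Context: $\mathcal A$ is a finite alphabet; morphisms satisfy $\varphi(vw)=\varphi(v)\varphi(w)$, antimorphisms $\varphi(vw)=\varphi(w)\varphi(v)$; elements of $G$ permute letters. An infinite word $\mathbf u$ contains every letter of $\mathcal A$; $\mathcal L(\mathbf u)$ is its set of factors. $[w]=\{\mu(w):\mu\in G\}$. $w$ is a $G$-palindrome if $\Theta(w)=w$ for some antimorphism $\Theta\in G$ (including the empty word). A $G$-occurrence of $w$ in $v$ is an index $i$ such that some $w'\in[w]$ occurs at position $i$ in $v$ (every index is an occurrence of the empty word); $w$ is $G$-unioccurrent in $v$ if $w$ occurs in $v$ and there is no other $G$-occurrence of $w$ in $v$. A factor $v\in\mathcal L(\mathbf u)$ with $|v|>|w|$ is a complete $G$-return word of $[w]$ if a prefix and a suffix of $v$ belong to $[w]$ and $v$ contains no other $G$-occurrence of $w$. Property $G$-crw$(N)$: for all $w\in\mathcal L(\mathbf u)$ with $|w|\ge N$, every complete $G$-return word of $[w]$ is a $G$-palindrome. $G$-lps$(v)$ is the longest suffix of $v$ that is a $G$-palindrome. Property $G$-lps$(N)$: for all $w\in\mathcal L(\mathbf u)$ with $|w|\ge N$, either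 $G$-lps$(w)$ is $G$-unioccurrent in $w$, or the suffix of $w$ of length 1 has exactly one $G$-occurrence in $w$. -}

module Defs where

open import Data.Nat using (ℕ; zero; suc; _+_; _∸_; _≤_; _<_)
open import Data.Fin using (Fin)
open import Data.Bool using (Bool; true; false; if_then_else_; _xor_)
open import Data.List using (List; []; _∷_; _++_; map; reverse; length)
open import Data.List.Membership.Propositional using (_∈_)
open import Data.Product using (Σ; ∃; _×_; _,_)
open import Data.Sum using (_⊎_)
open import Relation.Binary.PropositionalEquality using (_≡_)
open import Relation.Nullary using (¬_)
open import Function using (_∘_)
open import Function.Definitions using (Injective)

Word : ℕ → Set
Word k = List (Fin k)

-- An element of G: a morphism or antimorphism of 𝒜* that permutes letters,
-- given by its action on letters and a flag (anti = true: antimorphism).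
record Elem (k : ℕ) : Set where
  constructor elem
  field
    perm : Fin k → Fin k
    anti : Bool
open Elem public

act : ∀ {k} → Elem k → Word k → Word k
act g w = if anti g then reverse (map (perm g) w) else map (perm g) w

record IsFiniteGroup {k : ℕ} (G : List (Elem k)) : Set where
  field
    perm-injective : ∀ {g} → g ∈ G → Injective _≡_ _≡_ (perm g)
    identity : Σ (Elem k) λ e → e ∈ G × (∀ w → act e w ≡ w)
    closed : ∀ {g h} → g ∈ G → h ∈ G →
             Σ (Elem k) λ f → f ∈ G × (∀ w → act f w ≡ act g (act h w))
    inverse : ∀ {g} → g ∈ G →
              Σ (Elem k) λ h → h ∈ G × (∀ w → act h (act g w) ≡ w)

HasAntimorphism : ∀ {k} → List (Elem k) → Set
HasAntimorphism G = Σ _ λ g → g ∈ G × anti g ≡ true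

InfWord : ℕ → Set
InfWord k = ℕ → Fin k

ContainsAllLetters : ∀ {k} → InfWord k → Set
ContainsAllLetters {k} u = ∀ (a : Fin k) → ∃ λ i → u i ≡ a

slice : ∀ {k} → InfWord k → ℕ → ℕ → Word k
slice u i zero = []
slice u i (suc n) = u i ∷ slice u (suc i) n

Factor : ∀ {k} → InfWord k → Word k → Set
Factor u w = ∃ λ i → slice u i (length w) ≡ w

module _ {k : ℕ} (G : List (Elem k)) where

  InClass : Word k → Word k → Set
  InClass w w' = Σ (Elem k) λ μ → μ ∈ G × act μ w ≡ w'

  GPal : Word k → Set
  GPal w = Σ (Elem k) λ Θ → Θ ∈ G × anti Θ ≡ true × act Θ w ≡ w

  OccursAt : Word k → Word k → ℕ → Set
  OccursAt w' v i = Σ (Word k) λ s → Σ (Word k) λ t → v ≡ s ++ w' ++ t × length s ≡ i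

  GOcc : Word k → Word k → ℕ → Set
  GOcc w v i = Σ (Word k) λ w' → InClass w w' × OccursAt w' v i

  GUnioccurrent : Word k → Word k → Set
  GUnioccurrent w v = Σ ℕ λ i → OccursAt w v i × (∀ j → GOcc w v j → j ≡ i)

  IsSuffix : Word k → Word k → Set
  IsSuffix p v = Σ (Word k) λ s → s ++ p ≡ v

  IsPrefix : Word k → Word k → Set
  IsPrefix p v = Σ (Word k) λ t → p ++ t ≡ v

  IsGLps : Word k → Word k → Set
  IsGLps v p = IsSuffix p v × GPal p ×
               (∀ q → IsSuffix q v → GPal q → length q ≤ length p)

  module _ (u : InfWord k) where

    CompleteReturn : Word k → Word k → Set
    CompleteReturn w v =
      Factor u v × length w < length v ×
      (Σ (Word k) λ p → InClass w p × IsPrefix p v) ×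
      (Σ (Word k) λ s → InClass w s × IsSuffix s v) ×
      (∀ j → GOcc w v j → j ≡ 0 ⊎ j ≡ length v ∸ length w)

    GCrw : ℕ → Set
    GCrw N = ∀ w → Factor u w → N ≤ length w →
             ∀ v → CompleteReturn w v → GPal v

    LastLetterUnique : Word k → Set
    LastLetterUnique w = Σ (Word k) λ w₀ → Σ (Fin k) λ a →
      w ≡ w₀ ++ (a ∷ []) × (∀ j → GOcc (a ∷ []) w j → j ≡ length w₀)

    GLps : ℕ → Set
    GLps N = ∀ w → Factor u w → N ≤ length w →
             (∀ p → IsGLps w p → GUnioccurrent p w) ⊎ LastLetterUnique w

module Submission where

open import Defs
open import Data.Nat using (ℕ; _<_; _∸_)
open import Data.List using (List)
open import Data.Product using (_×_)

open import Data.Nat using (suc; _+_; _≤_; z≤n; s≤s)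
open import Data.Nat.Properties
import Data.Fin.Properties as Fin
open import Data.Bool using (true; false)
import Data.Bool.Properties as Bool
open import Data.List using ([]; _∷_; _++_; map; reverse; length)
open import Data.List.Properties
  using (map-++; reverse-++; length-reverse; length-map; length-++; length-++-≤ʳ;
         ++-identityʳ; ++-assoc; ∷-injectiveʳ; ≡-dec)
open import Data.List.Membership.Propositional using (_∈_; find; lose)
open import Data.List.Relation.Unary.Any using (any?)
open import Data.Product using (∃; _,_)
open import Data.Sum using (_⊎_; inj₁; inj₂)
open import Relation.Nullary using (¬_; Dec; yes; no; contradiction)
open import Relation.Nullary.Decidable using (_×-dec_)
open import Relation.Binary.PropositionalEquality

-- Let v be a complete G-return word of [w], with prefix q and suffix s in [w].
-- A suffix of v no longer than w is a suffix of s, so its image under the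
-- element of G carrying s to q is a G-occurrence strictly earlier in v; hence
-- neither the last letter nor a G-unioccurrent G-lps(v) can be that short.
-- So G-lps(v) is longer than w and contains s; applying the antimorphism that
-- fixes it turns s into a G-occurrence of w at the start of G-lps(v), which
-- must be position 0: G-lps(v) = v.

length-suffix-≤ : ∀ {A : Set} {s q v : List A} → s ++ q ≡ v → length q ≤ length v
length-suffix-≤ {s = s} refl = length-++-≤ʳ _ {s}

suffix-∷ : ∀ {A : Set} (s : List A) {q a v} → s ++ q ≡ a ∷ v →
           q ≡ a ∷ v ⊎ ∃ λ s′ → s′ ++ q ≡ v
suffix-∷ []      eq = inj₁ eq
suffix-∷ (_ ∷ s) eq = inj₂ (s , ∷-injectiveʳ eq)

suffix-of-longer-suffix : ∀ {A : Set} (x p y s : List A) → x ++ p ≡ y ++ s →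
                          length s ≤ length p → ∃ λ z → z ++ s ≡ p
suffix-of-longer-suffix []      p y       s eq s≤p = y , sym eq
suffix-of-longer-suffix (a ∷ x) p []      _ refl s≤p =
  contradiction s≤p (<⇒≱ (s≤s (length-++-≤ʳ p {x})))
suffix-of-longer-suffix (a ∷ x) p (b ∷ y) s eq s≤p =
  suffix-of-longer-suffix x p y s (∷-injectiveʳ eq) s≤p

length-≡0⇒[] : ∀ {A : Set} (x : List A) → length x ≡ 0 → x ≡ []
length-≡0⇒[] [] _ = refl

module _ {k : ℕ} where

  length-act : ∀ g (w : Word k) → length (act g w) ≡ length w
  length-act (elem f true)  w = trans (length-reverse (map f w)) (length-map f w)
  length-act (elem f false) w = length-map f w

  act-anti-++ : ∀ g → anti g ≡ true → (x y : Word k) → act g (x ++ y) ≡ act g y ++ act g x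
  act-anti-++ (elem f true) refl x y =
    trans (cong reverse (map-++ f x y)) (reverse-++ (map f x) (map f y))

  act-++-infix : ∀ g (z p : Word k) → ∃ λ l → ∃ λ r →
                 act g (z ++ p) ≡ l ++ act g p ++ r × length l ≤ length z
  act-++-infix g@(elem f true) z p = [] , act g z , act-anti-++ g refl z p , z≤n
  act-++-infix (elem f false) z p =
    map f z , [] , trans (map-++ f z p) (cong (map f z ++_) (sym (++-identityʳ (map f p)))) ,
    ≤-reflexive (length-map f z)

module _ {k : ℕ} {G : List (Elem k)} where

  inClass-length : ∀ {w s} → InClass G w s → length s ≡ length w
  inClass-length {w} (ν , _ , refl) = length-act ν w

  gpal-[] : HasAntimorphism G → GPal G []
  gpal-[] (Θ@(elem f true) , Θ∈ , refl) = Θ , Θ∈ , refl , refl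

  gpal? : ∀ w → Dec (GPal G w)
  gpal? w with any? (λ Θ → (anti Θ Bool.≟ true) ×-dec ≡-dec Fin._≟_ (act Θ w) w) G
  ... | yes found = let (Θ , Θ∈ , isAnti , fixes) = find found in yes (Θ , Θ∈ , isAnti , fixes)
  ... | no none   = no λ (Θ , Θ∈ , isAnti , fixes) → none (lose Θ∈ (isAnti , fixes))

  glps : HasAntimorphism G → ∀ v → ∃ λ p → IsGLps G v p
  glps hasAnti []      =
    [] , ([] , refl) , gpal-[] hasAnti , λ q (s , s++q≡[]) _ → length-suffix-≤ {s = s} s++q≡[]
  glps hasAnti (a ∷ v) with gpal? (a ∷ v)
  ... | yes pal = a ∷ v , ([] , refl) , pal , λ q (s , s++q≡) _ → length-suffix-≤ {s = s} s++q≡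
  ... | no ¬pal with glps hasAnti v
  ... | p , (s , s++p≡v) , pal , longest = p , (a ∷ s , cong (a ∷_) s++p≡v) , pal , longest′
    where
    longest′ : ∀ q → IsSuffix G q (a ∷ v) → GPal G q → length q ≤ length p
    longest′ q (s′ , s′++q≡) palq with suffix-∷ s′ s′++q≡
    ... | inj₁ refl = contradiction palq ¬pal
    ... | inj₂ q⊑v  = longest q q⊑v palq

module _ {k : ℕ} {G : List (Elem k)} (isG : IsFiniteGroup G) where
  open IsFiniteGroup isG

  inClass-transport : ∀ {w s q} → InClass G w s → InClass G w q →
                      ∃ λ ρ → ρ ∈ G × act ρ s ≡ q
  inClass-transport {w} (ν , ν∈ , refl) (μ , μ∈ , refl) with inverse ν∈
  ... | ν⁻¹ , ν⁻¹∈ , ν⁻¹ν with closed μ∈ ν⁻¹∈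
  ... | f , f∈ , f≡ = f , f∈ , trans (f≡ (act ν w)) (cong (act μ) (ν⁻¹ν w))

  inClass-act : ∀ {w s} Θ → Θ ∈ G → InClass G w s → InClass G w (act Θ s)
  inClass-act Θ Θ∈ (ν , ν∈ , refl) with closed Θ∈ ν∈
  ... | f , f∈ , f≡ = f , f∈ , f≡ _

  gOcc-suffix : ∀ x p → GOcc G p (x ++ p) (length x)
  gOcc-suffix x p with identity
  ... | e , e∈ , e≡ = p , (e , e∈ , e≡ p) , x , [] , cong (x ++_) (sym (++-identityʳ p)) , refl

  gOcc-image-of-suffix : ∀ {w s q t} z p → z ++ p ≡ s → InClass G w s → InClass G w q →
                         ∃ λ j → GOcc G p (q ++ t) j × j ≤ length z
  gOcc-image-of-suffix {t = t} z p refl s∈ q∈ with inClass-transport s∈ q∈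
  ... | ρ , ρ∈ , refl with act-++-infix ρ z p
  ... | l , r , ρzp≡ , l≤z = length l , (act ρ p , (ρ , ρ∈ , refl) , l , r ++ t , q≡ , refl) , l≤z
    where
    open ≡-Reasoning
    q≡ : act ρ (z ++ p) ++ t ≡ l ++ act ρ p ++ r ++ t
    q≡ = begin
      act ρ (z ++ p) ++ t       ≡⟨ cong (_++ t) ρzp≡ ⟩
      (l ++ act ρ p ++ r) ++ t  ≡⟨ ++-assoc l _ t ⟩
      l ++ (act ρ p ++ r) ++ t  ≡⟨ cong (l ++_) (++-assoc (act ρ p) r t) ⟩
      l ++ act ρ p ++ r ++ t    ∎

  short-suffix-occurs-earlier : ∀ {u w v} → CompleteReturn G u w v → ∀ x p → x ++ p ≡ v →
                                length p ≤ length w → ∃ λ j → GOcc G p v j × j < length x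
  short-suffix-occurs-earlier (_ , w<v , (q , q∈ , t , q++t≡) , (s , s∈ , y , y++s≡) , _) x p refl p≤w
    with suffix-of-longer-suffix y s x p y++s≡ (≤-trans p≤w (≤-reflexive (sym (inClass-length s∈))))
  ... | z , z++p≡s with gOcc-image-of-suffix {t = t} z p z++p≡s s∈ q∈
  ... | j , occ , j≤z = j , subst (λ v → GOcc G p v j) q++t≡ occ , ≤-<-trans j≤z z<x
    where
    z<x : length z < length x
    z<x = +-cancelʳ-< (length p) (length z) (length x)
      (subst₂ _<_ (trans (cong length (sym z++p≡s)) (length-++ z)) (length-++ x)
        (subst (_< length (x ++ p)) (sym (inClass-length s∈)) w<v))

  ¬lastLetterUnique : ∀ {u w v} → CompleteReturn G u w v → 1 ≤ length w → ¬ LastLetterUnique G u v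
  ¬lastLetterUnique ret 1≤w (v₀ , a , v≡ , only-v₀)
    with short-suffix-occurs-earlier ret v₀ (a ∷ []) (sym v≡) 1≤w
  ... | j , occ , j<v₀ = <⇒≢ j<v₀ (only-v₀ j occ)

  unioccurrent-suffix-longer : ∀ {u w v} → CompleteReturn G u w v → ∀ x p → x ++ p ≡ v →
                               GUnioccurrent G p v → length w < length p
  unioccurrent-suffix-longer {w = w} ret x p refl (_ , _ , only-i) with length w <? length p
  ... | yes w<p = w<p
  ... | no w≮p with short-suffix-occurs-earlier ret x p refl (≮⇒≥ w≮p)
  ... | j , occ , j<x = contradiction (trans (only-i j occ) (sym (only-i (length x) (gOcc-suffix x p))))
                                      (<⇒≢ j<x)

  long-gpal-suffix-is-whole : ∀ {u w v} → CompleteReturn G u w v → ∀ x p → x ++ p ≡ v →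
                              GPal G p → length w < length p → p ≡ v
  long-gpal-suffix-is-whole {w = w} (_ , w<v , _ , (s , s∈ , y , y++s≡) , only-ends) x p refl
                            (Θ , Θ∈ , isAnti , Θp≡p) w<p
    with suffix-of-longer-suffix x p y s (sym y++s≡) (≤-trans (≤-reflexive (inClass-length s∈)) (<⇒≤ w<p))
  ... | z , z++s≡p with only-ends (length x) (act Θ s , inClass-act Θ Θ∈ s∈ , x , act Θ z , x++p≡ , refl)
    where
    x++p≡ : x ++ p ≡ x ++ act Θ s ++ act Θ z
    x++p≡ = cong (x ++_) (trans (sym Θp≡p) (trans (cong (act Θ) (sym z++s≡p)) (act-anti-++ Θ isAnti z s)))
  ... | inj₁ |x|≡0 = cong (_++ p) (sym (length-≡0⇒[] x |x|≡0))
  ... | inj₂ |x|≡  = contradiction (+-cancelˡ-≡ (length x) (length w) (length p) x+w≡x+p) (<⇒≢ w<p)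
    where
    open ≡-Reasoning
    x+w≡x+p : length x + length w ≡ length x + length p
    x+w≡x+p = begin
      length x + length w                   ≡⟨ cong (_+ length w) |x|≡ ⟩
      length (x ++ p) ∸ length w + length w ≡⟨ m∸n+n≡m (<⇒≤ w<v) ⟩
      length (x ++ p)                       ≡⟨ length-++ x ⟩
      length x + length p                   ∎

  complete-return-gpal : HasAntimorphism G → ∀ {u w v} → CompleteReturn G u w v → 1 ≤ length w →
                         (∀ p → IsGLps G v p → GUnioccurrent G p v) ⊎ LastLetterUnique G u v → GPal G v
  complete-return-gpal _ ret 1≤w (inj₂ last) = contradiction last (¬lastLetterUnique ret 1≤w)
  complete-return-gpal hasAnti {v = v} ret 1≤w (inj₁ unioccurrent) with glps hasAnti v
  ... | p , lps@((x , x++p≡v) , pal , _) =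
    subst (GPal G) (long-gpal-suffix-is-whole ret x p x++p≡v pal
                     (unioccurrent-suffix-longer ret x p x++p≡v (unioccurrent p lps))) pal

  gLps⇒gCrw : HasAntimorphism G → ∀ {u} M N → 1 ≤ M → N ≤ suc M → GLps G u N → GCrw G u M
  gLps⇒gCrw hasAnti M N 1≤M N≤1+M lps w _ M≤w v ret@(v∈u , w<v , _) =
    complete-return-gpal hasAnti ret (≤-trans 1≤M M≤w)
      (lps v v∈u (≤-trans N≤1+M (≤-trans (s≤s M≤w) w<v)))

mainTheorem12 : (k : ℕ) (G : List (Elem k)) → IsFiniteGroup G → HasAntimorphism G →
    (u : InfWord k) → ContainsAllLetters u →
    (GLps G u 1 → GCrw G u 1) ×
    (∀ N → 1 < N → GLps G u N → GCrw G u (N ∸ 1))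
mainTheorem12 k G isG hasAnti u _ =
  gLps⇒gCrw isG hasAnti 1 1 ≤-refl (s≤s z≤n) ,
  λ { (suc M) (s≤s 1≤M) → gLps⇒gCrw isG hasAnti M (suc M) 1≤M ≤-refl }
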